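{- (i) If $\beta\in For$ is an $L_3$-contradiction, then $\Gamma\nvDash^{\mathbb{P}}_{L_3}\beta$ for every $\Gamma\subseteq For$. (ii) If $\beta$ is an $L_3$-tautology and $\{\beta\}\vDash^{\mathbb{P}}_{L_3}\gamma$, then $\gamma$ is an $L_3$-tautology and $\Gamma\vDash^{\mathbb{P}}_{L_3}\gamma$ for every $\Gamma\subseteq For$. (iii) If $\{\alpha\}\vDash^{\mathbb{P}}_{L_3}\beta$, then $\beta$ is an $L_3$-tautology, or $\{\alpha\}$ is $L_3$-consistent and $\{\alpha\}\vDash_{L_3}\beta$.
   Context: $For$ is the set of formulas built from a countable set $Prop$ of propositional letters with $\neg,\vee,\wedge,\rightarrow$. $L_3$ (Łukasiewicz) is given by the matrix with truth values $\{0,1/2,1\}$, designated set $\{1\}$, $f_\neg(x)=1-x$, $f_\vee=\max$, $f_\wedge=\min$, $f_\rightarrow(x,y)=\min\{1,1-x+y\}$; valuations are maps $Prop\to\{0,1/2,1\}$ extended via these functions. A formula is an $L_3$-tautology if every valuation gives it value $1$, and an $L_3$-contradiction if every valuation gives it value $0$. $\Gamma\vDash_{L_3}\alpha$ iff every valuation giving all members of $\Gamma$ value $1$ gives $\alpha$ value $1$; $\Gamma$ is $L_3$-consistent iff $\{\alpha:\Gamma\vDash_{L_3}\alpha\}\neq For$. $\Gamma\vDash^{\mathbb{P}}_{L_3}\alpha$ iff there exists an $L_3$-consistent $\Gamma'\subseteq\Gamma$ with $\Gamma'\vDash_{L_3}\alpha$. -}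

module Defs where

open import Data.Nat using (ℕ)
open import Data.Product using (Σ; ∃; _×_)
open import Relation.Binary.PropositionalEquality using (_≡_)
open import Relation.Nullary using (¬_)
open import Level using (0ℓ)
open import Relation.Unary using (Pred; _⊆_; ｛_｝)

data For : Set where
  var  : ℕ → For
  ¬'_  : For → For
  _∨'_ : For → For → For
  _∧'_ : For → For → For
  _⇒'_ : For → For → For

-- Truth values {0, 1/2, 1}: v0 = 0, vh = 1/2, v1 = 1
data V3 : Set where
  v0 vh v1 : V3

-- f¬(x) = 1 - x
f¬ : V3 → V3
f¬ v0 = v1
f¬ vh = vh
f¬ v1 = v0

-- f∨ = max
f∨ : V3 → V3 → V3
f∨ v0 y = y
f∨ vh v0 = vh
f∨ vh vh = vh
f∨ vh v1 = v1
f∨ v1 y = v1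

-- f∧ = min
f∧ : V3 → V3 → V3
f∧ v0 y = v0
f∧ vh v0 = v0
f∧ vh vh = vh
f∧ vh v1 = vh
f∧ v1 y = y

-- f→(x,y) = min{1, 1 - x + y}
f⇒ : V3 → V3 → V3
f⇒ v0 y  = v1
f⇒ vh v0 = vh
f⇒ vh vh = v1
f⇒ vh v1 = v1
f⇒ v1 y  = y

Valuation : Set
Valuation = ℕ → V3

⟦_⟧ : For → Valuation → V3
⟦ var p ⟧ v = v p
⟦ ¬' a ⟧ v = f¬ (⟦ a ⟧ v)
⟦ a ∨' b ⟧ v = f∨ (⟦ a ⟧ v) (⟦ b ⟧ v)
⟦ a ∧' b ⟧ v = f∧ (⟦ a ⟧ v) (⟦ b ⟧ v)
⟦ a ⇒' b ⟧ v = f⇒ (⟦ a ⟧ v) (⟦ b ⟧ v)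

FSet : Set₁
FSet = Pred For 0ℓ

Tautology : For → Set
Tautology a = ∀ (v : Valuation) → ⟦ a ⟧ v ≡ v1

Contradiction : For → Set
Contradiction a = ∀ (v : Valuation) → ⟦ a ⟧ v ≡ v0

_⊨_ : FSet → For → Set
Γ ⊨ a = ∀ (v : Valuation) → (∀ g → Γ g → ⟦ g ⟧ v ≡ v1) → ⟦ a ⟧ v ≡ v1

Consistent : FSet → Set
Consistent Γ = ∃ λ a → ¬ (Γ ⊨ a)

_⊨ᴾ_ : FSet → For → Set₁
Γ ⊨ᴾ a = Σ FSet λ Γ' → (Γ' ⊆ Γ) × Consistent Γ' × (Γ' ⊨ a)

sing : For → FSet
sing a = ｛ a ｝

-- Whether a paraconsistent consequence set Γ' ⊆ {α} is empty or {α} cannot be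
-- decided, but whether α is satisfiable can: α depends only on finitely many
-- letters, so only finitely many valuations matter.  If α is satisfiable, {α} is
-- consistent and entails whatever Γ' does; if not, a consistent Γ' cannot
-- contain α, so Γ' is empty and everything it entails is a tautology.
module Submission where

open import Defs
open import Data.Empty using (⊥-elim)
open import Data.Nat using (ℕ; zero; suc; _<_; _≤_; _⊔_; s≤s)
open import Data.Nat.Properties using (_≟_; ≤-refl; <-≤-trans; m≤m⊔n; m≤n⊔m; ≤∧≢⇒<)
open import Data.Product using (_×_; _,_; ∃)
open import Data.Sum using (_⊎_; inj₁; inj₂; [_,_])
open import Level using (0ℓ)
open import Relation.Binary.PropositionalEquality using (_≡_; refl; sym; trans; cong; cong₂; subst)
open import Relation.Nullary using (¬_; Dec; yes; no)
open import Relation.Nullary.Decidable using (map′; _⊎-dec_)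
open import Relation.Unary using (Pred; _⊆_; ∅)
open import Relation.Unary.Properties using (∅-⊆)

_⊩_ : Valuation → FSet → Set
v ⊩ Γ = ∀ g → Γ g → ⟦ g ⟧ v ≡ v1

Satisfiable : For → Set
Satisfiable a = ∃ λ v → ⟦ a ⟧ v ≡ v1

falsum : For
falsum = ¬' (var 0 ⇒' var 0)

falsum-contradiction : Contradiction falsum
falsum-contradiction v with v 0
... | v0 = refl
... | vh = refl
... | v1 = refl

contradiction⇒unsatisfiable : ∀ a → Contradiction a → ¬ Satisfiable a
contradiction⇒unsatisfiable a c (v , a≡v1) with trans (sym (c v)) a≡v1
... | ()

model⇒consistent : ∀ {Γ : FSet} {v} → v ⊩ Γ → Consistent Γ
model⇒consistent {v = v} v⊩Γ =
  falsum , λ Γ⊨falsum →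
    contradiction⇒unsatisfiable falsum falsum-contradiction (v , Γ⊨falsum v v⊩Γ)

entails-unsatisfiable⇒inconsistent : ∀ {Γ : FSet} a → Γ ⊨ a → ¬ Satisfiable a → ¬ Consistent Γ
entails-unsatisfiable⇒inconsistent a Γ⊨a unsat (b , Γ⊭b) =
  Γ⊭b λ v v⊩Γ → ⊥-elim (unsat (v , Γ⊨a v v⊩Γ))

⊨-mono : ∀ {Γ Δ : FSet} a → Γ ⊆ Δ → Γ ⊨ a → Δ ⊨ a
⊨-mono a Γ⊆Δ Γ⊨a v v⊩Δ = Γ⊨a v λ g Γg → v⊩Δ g (Γ⊆Δ Γg)

⊨-member : ∀ {Γ : FSet} a → Γ a → Γ ⊨ a
⊨-member a Γa v v⊩Γ = v⊩Γ _ Γa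

⊨-from-tautologies : ∀ {Γ : FSet} a → (∀ g → Γ g → Tautology g) → Γ ⊨ a → Tautology a
⊨-from-tautologies a taut Γ⊨a v = Γ⊨a v λ g Γg → taut g Γg v

tautology⇒⊨ᴾ : ∀ a → Tautology a → ∀ Γ → Γ ⊨ᴾ a
tautology⇒⊨ᴾ a taut Γ =
  ∅ , ∅-⊆ Γ , model⇒consistent {v = λ _ → v0} (λ _ ()) , λ v _ → taut v

⊆-sing-inhabited : ∀ {Γ : FSet} {a} → Γ ⊆ sing a → ∀ {g} → Γ g → Γ a
⊆-sing-inhabited {Γ} Γ⊆a Γg = subst Γ (sym (Γ⊆a Γg)) Γg

_≈[_]_ : Valuation → ℕ → Valuation → Set
v ≈[ n ] w = ∀ i → i < n → v i ≡ w i

≈-weaken : ∀ {m n v w} → m ≤ n → v ≈[ n ] w → v ≈[ m ] w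
≈-weaken m≤n v≈w i i<m = v≈w i (<-≤-trans i<m m≤n)

≈-⊔ˡ : ∀ {m n v w} → v ≈[ m ⊔ n ] w → v ≈[ m ] w
≈-⊔ˡ = ≈-weaken (m≤m⊔n _ _)

≈-⊔ʳ : ∀ {m n v w} → v ≈[ m ⊔ n ] w → v ≈[ n ] w
≈-⊔ʳ {m} = ≈-weaken (m≤n⊔m m _)

InvariantBelow : ℕ → Pred Valuation 0ℓ → Set
InvariantBelow n P = ∀ {v w} → v ≈[ n ] w → P v → P w

_[_≔_] : Valuation → ℕ → V3 → Valuation
(v [ n ≔ x ]) i with i ≟ n
... | yes _ = x
... | no _  = v i

≔-self : ∀ v n → v ≈[ suc n ] (v [ n ≔ v n ])
≔-self v n i _ with i ≟ n
... | yes refl = refl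
... | no _     = refl

≔-cong : ∀ {v w n} x → v ≈[ n ] w → (v [ n ≔ x ]) ≈[ suc n ] (w [ n ≔ x ])
≔-cong {n = n} x v≈w i (s≤s i≤n) with i ≟ n
... | yes _ = refl
... | no i≢n = v≈w i (≤∧≢⇒< i≤n i≢n)

∃V3? : {P : V3 → Set} → (∀ x → Dec (P x)) → Dec (∃ P)
∃V3? P? = map′ [ (v0 ,_) , [ (vh ,_) , (v1 ,_) ] ] witness (P? v0 ⊎-dec P? vh ⊎-dec P? v1)
  where
  witness : ∀ {P} → ∃ P → P v0 ⊎ P vh ⊎ P v1
  witness (v0 , p) = inj₁ p
  witness (vh , p) = inj₂ (inj₁ p)
  witness (v1 , p) = inj₂ (inj₂ p)

-- Induction on n: the last relevant letter n is quantified away over V3,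
-- leaving a predicate invariant below n.
∃-invariantBelow? : ∀ n {P} → InvariantBelow n P → (∀ v → Dec (P v)) → Dec (∃ P)
∃-invariantBelow? zero inv P? with P? (λ _ → v0)
... | yes p = yes (_ , p)
... | no ¬p = no λ (v , p) → ¬p (inv (λ _ ()) p)
∃-invariantBelow? (suc n) {P} inv P? =
  map′ (λ (v , x , p) → v [ n ≔ x ] , p)
       (λ (v , p) → v , v n , inv (≔-self v n) p)
       (∃-invariantBelow? n invQ (λ v → ∃V3? λ x → P? (v [ n ≔ x ])))
  where
  invQ : InvariantBelow n (λ v → ∃ λ x → P (v [ n ≔ x ]))
  invQ v≈w (x , p) = x , inv (≔-cong x v≈w) p

varBound : For → ℕ
varBound (var p)  = suc p
varBound (¬' a)   = varBound a
varBound (a ∨' b) = varBound a ⊔ varBound b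
varBound (a ∧' b) = varBound a ⊔ varBound b
varBound (a ⇒' b) = varBound a ⊔ varBound b

⟦⟧-cong : ∀ a {v w} → v ≈[ varBound a ] w → ⟦ a ⟧ v ≡ ⟦ a ⟧ w
⟦⟧-cong (var p)  v≈w = v≈w p ≤-refl
⟦⟧-cong (¬' a)   v≈w = cong f¬ (⟦⟧-cong a v≈w)
⟦⟧-cong (a ∨' b) v≈w = cong₂ f∨ (⟦⟧-cong a (≈-⊔ˡ v≈w)) (⟦⟧-cong b (≈-⊔ʳ v≈w))
⟦⟧-cong (a ∧' b) v≈w = cong₂ f∧ (⟦⟧-cong a (≈-⊔ˡ v≈w)) (⟦⟧-cong b (≈-⊔ʳ v≈w))
⟦⟧-cong (a ⇒' b) v≈w = cong₂ f⇒ (⟦⟧-cong a (≈-⊔ˡ v≈w)) (⟦⟧-cong b (≈-⊔ʳ v≈w))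

≡v1? : (x : V3) → Dec (x ≡ v1)
≡v1? v0 = no λ ()
≡v1? vh = no λ ()
≡v1? v1 = yes refl

satisfiable? : ∀ a → Dec (Satisfiable a)
satisfiable? a = ∃-invariantBelow? (varBound a)
  (λ v≈w a≡v1 → trans (sym (⟦⟧-cong a v≈w)) a≡v1) (λ v → ≡v1? (⟦ a ⟧ v))

lemma12 : (∀ (β : For) → Contradiction β → ∀ (Γ : FSet) → ¬ (Γ ⊨ᴾ β))
    × (∀ (β γ : For) → Tautology β → sing β ⊨ᴾ γ → Tautology γ × (∀ (Γ : FSet) → Γ ⊨ᴾ γ))
    × (∀ (α β : For) → sing α ⊨ᴾ β → Tautology β ⊎ (Consistent (sing α) × (sing α ⊨ β)))
lemma12 = part-i , part-ii , part-iii
  where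
  part-i : ∀ β → Contradiction β → ∀ Γ → ¬ (Γ ⊨ᴾ β)
  part-i β c Γ (Γ' , _ , cons , Γ'⊨β) =
    entails-unsatisfiable⇒inconsistent β Γ'⊨β (contradiction⇒unsatisfiable β c) cons

  part-ii : ∀ β γ → Tautology β → sing β ⊨ᴾ γ → Tautology γ × (∀ Γ → Γ ⊨ᴾ γ)
  part-ii β γ taut (Γ' , Γ'⊆β , _ , Γ'⊨γ) = tautγ , tautology⇒⊨ᴾ γ tautγ
    where
    tautγ : Tautology γ
    tautγ = ⊨-from-tautologies γ (λ g Γ'g → subst Tautology (Γ'⊆β Γ'g) taut) Γ'⊨γ

  part-iii : ∀ α β → sing α ⊨ᴾ β → Tautology β ⊎ (Consistent (sing α) × (sing α ⊨ β))
  part-iii α β (Γ' , Γ'⊆α , cons , Γ'⊨β) with satisfiable? α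
  ... | yes (v , α≡v1) =
    inj₂ (model⇒consistent (λ g α≡g → subst (λ x → ⟦ x ⟧ v ≡ v1) α≡g α≡v1)
         , ⊨-mono β Γ'⊆α Γ'⊨β)
  ... | no unsat = inj₁ λ v → Γ'⊨β v λ g Γ'g → ⊥-elim (α∉Γ' (⊆-sing-inhabited Γ'⊆α Γ'g))
    where
    α∉Γ' : ¬ Γ' α
    α∉Γ' Γ'α = entails-unsatisfiable⇒inconsistent α (⊨-member α Γ'α) unsat cons
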